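{- Let $m$ and $D$ be numbers and let $(a_1,\ldots,a_D)$ be a sequence of positive integers with $D\ge 48\log^2 m$ and $\sum_{i=1}^D a_i\le m$. Then there exists an index $j\in[D/4,3D/4]$ such that \[ a_j\le \frac{1}{12\log m}\cdot\min\Big(\sum_{i=1}^{j-1}a_i,\ \sum_{i=j+1}^{D}a_i\Big). \]
   Context: $\log$ denotes the base-2 logarithm. -}

module Defs where

open import Data.Nat using (ℕ; zero; suc; _+_; _*_; _^_; _≤_; _<_)

sumFrom : (ℕ → ℕ) → ℕ → ℕ → ℕ
sumFrom a s zero    = 0
sumFrom a s (suc n) = a s + sumFrom a (suc s) n

-- Exact integer encodings of real inequalities involving log = log₂,
-- valid for m ≥ 1 (so log m ≥ 0).

-- "p / q < log m"  (q > 0)   ⟺  2^p < m^q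
RatBelowLog : ℕ → ℕ → ℕ → Set
RatBelowLog p q m = 2 ^ p < m ^ q

-- "48 · (log m)² ≤ D"  ⟺  log m ≤ √(D/48)
--   ⟺  every nonnegative rational p/q below log m satisfies 48 (p/q)² ≤ D
LogSqBound : ℕ → ℕ → Set
LogSqBound m D = ∀ p q → 0 < q → RatBelowLog p q m → 48 * (p * p) ≤ D * (q * q)

-- "c · log m ≤ S"  ⟺  log (m^c) ≤ S  ⟺  m^c ≤ 2^S
LogMulLe : ℕ → ℕ → ℕ → Set
LogMulLe c m S = m ^ c ≤ 2 ^ S

{-# OPTIONS --safe #-}

-- Take b with 2 ^ b < m ^ 12 ≤ 2 ^ (b + 1), so that B = b + 1 is 12 log m rounded up, and let
-- q = ⌊D/4⌋.  If no index of (q, 3q] is balanced, compare the prefix and suffix sums at 2q.  If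
-- the prefix sum is the smaller one, every j in (q, 2q] violates the prefix condition, so
-- a_j > P / B where P is the prefix sum before j; otherwise the suffix sums on (2q, 3q], read from
-- right to left, behave in the same way.  Along such a heavy run the partial sum grows by a factor
-- of at least 1 + 1/B per step, hence doubles every B steps; starting from at least q ≥ 7 it stays
-- below the total m only if ⌊q/B⌋ ≤ log m - 2, i.e. q < B²/12 - B, whereas q ≥ D/4 ≥ 12 log² m.

module Submission where

open import Defs
open import Data.Nat using (ℕ; _+_; _*_; _∸_; _≤_; _<_; suc)
open import Data.Product using (Σ; _×_)
open import Data.Nat using (zero; _^_; z≤n; s≤s; s≤s⁻¹; _≤?_; NonZero)
open import Data.Nat.Properties
open import Data.Nat.DivMod using (_/_; _%_; m≡m%n+[m/n]*n; m%n<n; m/n*n≤m; /-monoˡ-≤)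
open import Data.Nat.Tactic.RingSolver using (solve-∀)
open import Data.Product using (_,_)
open import Data.Sum using (inj₁; inj₂)
open import Data.Empty using (⊥; ⊥-elim)
open import Function using (_∘_)
open import Relation.Nullary using (¬_; Dec; yes; no)
open import Relation.Nullary.Decidable using (_×-dec_; decidable-stable)
open import Relation.Binary.PropositionalEquality using (_≡_; refl; sym; trans; cong; subst; module ≡-Reasoning)

^-cancelˡ-≤ : ∀ m {x y} → 1 < m → m ^ x ≤ m ^ y → x ≤ y
^-cancelˡ-≤ m 1<m mˣ≤mʸ = ≮⇒≥ (λ y<x → <⇒≱ (^-monoʳ-< m 1<m y<x) mˣ≤mʸ)

n<2^n : ∀ n → n < 2 ^ n
n<2^n zero    = s≤s z≤n
n<2^n (suc n) = +-mono-≤ (m^n>0 2 n) (≤-trans (n<2^n n) (m≤m+n _ 0))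

between-powers-of-2 : ∀ {x} → 1 < x → Σ ℕ λ b → 2 ^ b < x × x ≤ 2 ^ suc b
between-powers-of-2 {x} 1<x = descend x (<⇒≤ (n<2^n x))
  where
  descend : ∀ k → x ≤ 2 ^ k → Σ ℕ λ b → 2 ^ b < x × x ≤ 2 ^ suc b
  descend zero    x≤1 = ⊥-elim (<⇒≱ 1<x x≤1)
  descend (suc k) x≤2^[1+k] with x ≤? 2 ^ k
  ... | yes x≤2^k = descend k x≤2^k
  ... | no  x≰2^k = k , ≰⇒> x≰2^k , x≤2^[1+k]

m<[1+m/n]*n : ∀ m n .{{_ : NonZero n}} → m < suc (m / n) * n
m<[1+m/n]*n m n = begin-strict
  m                  ≡⟨ m≡m%n+[m/n]*n m n ⟩
  m % n + m / n * n  <⟨ +-monoˡ-< (m / n * n) (m%n<n m n) ⟩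
  suc (m / n) * n    ∎
  where open ≤-Reasoning

LogMulLe-mono : ∀ {c m S S′} → S ≤ S′ → LogMulLe c m S → LogMulLe c m S′
LogMulLe-mono S≤S′ ok = ≤-trans ok (^-monoʳ-≤ 2 S≤S′)

¬LogMulLe⇒< : ∀ {B m c S} → m ^ 12 ≤ 2 ^ B → ¬ LogMulLe (12 * c) m S → S < B * c
¬LogMulLe⇒< {B} {m} {c} {S} m¹²≤2ᴮ ¬ok = ≰⇒> λ Bc≤S → ¬ok (begin
  m ^ (12 * c)   ≡⟨ ^-*-assoc m 12 c ⟨
  (m ^ 12) ^ c   ≤⟨ ^-monoˡ-≤ c m¹²≤2ᴮ ⟩
  (2 ^ B) ^ c    ≡⟨ ^-*-assoc 2 B c ⟩
  2 ^ (B * c)    ≤⟨ ^-monoʳ-≤ 2 Bc≤S ⟩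
  2 ^ S          ∎)
  where open ≤-Reasoning

module _ (a : ℕ → ℕ) where

  sumFrom-+ : ∀ s x y → sumFrom a s (x + y) ≡ sumFrom a s x + sumFrom a (s + x) y
  sumFrom-+ s zero    y rewrite +-identityʳ s = refl
  sumFrom-+ s (suc x) y rewrite sumFrom-+ (suc s) x y | +-suc s x = sym (+-assoc (a s) _ _)

  n≤sumFrom : ∀ s n → (∀ i → s ≤ i → i < s + n → 0 < a i) → n ≤ sumFrom a s n
  n≤sumFrom s zero    _   = z≤n
  n≤sumFrom s (suc n) pos = +-mono-≤ (pos s ≤-refl (m<m+n s (s≤s z≤n)))
    (n≤sumFrom (suc s) n λ i s<i i<s+1+n → pos i (<⇒≤ s<i) (subst (i <_) (sym (+-suc s n)) i<s+1+n))

module PrefixSuffix (a : ℕ → ℕ) (D : ℕ) where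

  prefix : ℕ → ℕ
  prefix x = sumFrom a 1 x

  suffix : ℕ → ℕ
  suffix j = sumFrom a (suc j) (D ∸ j)

  prefix-suc : ∀ x → prefix (suc x) ≡ prefix x + a (suc x)
  prefix-suc x = begin
    sumFrom a 1 (suc x)                ≡⟨ cong (sumFrom a 1) (+-comm 1 x) ⟩
    sumFrom a 1 (x + 1)                ≡⟨ sumFrom-+ a 1 x 1 ⟩
    prefix x + (a (suc x) + 0)         ≡⟨ cong (prefix x +_) (+-identityʳ _) ⟩
    prefix x + a (suc x)               ∎
    where open ≡-Reasoning

  prefix-mono : ∀ {x y} → x ≤ y → prefix x ≤ prefix y
  prefix-mono {x} {y} x≤y = begin
    prefix x                                  ≤⟨ m≤m+n _ _ ⟩
    prefix x + sumFrom a (suc x) (y ∸ x)      ≡⟨ sumFrom-+ a 1 x (y ∸ x) ⟨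
    prefix (x + (y ∸ x))                      ≡⟨ cong prefix (m+[n∸m]≡n x≤y) ⟩
    prefix y                                  ∎
    where open ≤-Reasoning

  prefix+suffix : ∀ {j} → j ≤ D → prefix j + suffix j ≡ prefix D
  prefix+suffix {j} j≤D = trans (sym (sumFrom-+ a 1 j (D ∸ j))) (cong prefix (m+[n∸m]≡n j≤D))

  suffix≤prefix : ∀ {j} → j ≤ D → suffix j ≤ prefix D
  suffix≤prefix {j} j≤D = subst (suffix j ≤_) (prefix+suffix j≤D) (m≤n+m _ _)

  suffix-anti : ∀ {j j′} → j ≤ j′ → j′ ≤ D → suffix j′ ≤ suffix j
  suffix-anti {j} {j′} j≤j′ j′≤D = +-cancelˡ-≤ (prefix j′) _ _ (begin
    prefix j′ + suffix j′  ≡⟨ prefix+suffix j′≤D ⟩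
    prefix D               ≡⟨ prefix+suffix (≤-trans j≤j′ j′≤D) ⟨
    prefix j + suffix j    ≤⟨ +-monoˡ-≤ (suffix j) (prefix-mono j≤j′) ⟩
    prefix j′ + suffix j   ∎)
    where open ≤-Reasoning

  suffix-suc : ∀ {j} → suc j ≤ D → suffix j ≡ suffix (suc j) + a (suc j)
  suffix-suc {j} j<D = begin
    sumFrom a (suc j) (D ∸ j)                 ≡⟨ cong (sumFrom a (suc j)) (+-∸-assoc 1 j<D) ⟩
    a (suc j) + suffix (suc j)                ≡⟨ +-comm (a (suc j)) _ ⟩
    suffix (suc j) + a (suc j)                ∎
    where open ≡-Reasoning

  module _ (positive : ∀ i → 1 ≤ i → i ≤ D → 0 < a i) where

    x≤prefix : ∀ {x} → x ≤ D → x ≤ prefix x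
    x≤prefix {x} x≤D = n≤sumFrom a 1 x λ i 1≤i i≤x → positive i 1≤i (≤-trans (s≤s⁻¹ i≤x) x≤D)

    D∸j≤suffix : ∀ {j} → j ≤ D → D ∸ j ≤ suffix j
    D∸j≤suffix {j} j≤D = n≤sumFrom a (suc j) (D ∸ j) λ i j<i i<1+D →
      positive i (≤-trans (s≤s z≤n) j<i) (s≤s⁻¹ (subst (i <_) (cong suc (m+[n∸m]≡n j≤D)) i<1+D))

module HeavyRun (B n : ℕ) .{{_ : NonZero B}} (T c : ℕ → ℕ)
  (step  : ∀ {k} → k < n → T (suc k) ≡ T k + c k)
  (heavy : ∀ {k} → k < n → T k < B * c k) where

  T-mono : ∀ k r → k + r ≤ n → T k ≤ T (k + r)
  T-mono k zero    _ = ≤-reflexive (cong T (sym (+-identityʳ k)))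
  T-mono k (suc r) h = begin
    T k                    ≤⟨ T-mono k r (<⇒≤ k+r<n) ⟩
    T (k + r)              ≤⟨ m≤m+n _ _ ⟩
    T (k + r) + c (k + r)  ≡⟨ step k+r<n ⟨
    T (suc (k + r))        ≡⟨ cong T (+-suc k r) ⟨
    T (k + suc r)          ∎
    where
    open ≤-Reasoning
    k+r<n : suc (k + r) ≤ n
    k+r<n = subst (_≤ n) (+-suc k r) h

  -- A heavy step raises B * T by at least suc (T k), as T is increasing.
  block-growth : ∀ k r → k + r ≤ n → (B + r) * T k + r ≤ B * T (k + r)
  block-growth k zero    _ rewrite +-identityʳ k | +-identityʳ B = ≤-reflexive (+-identityʳ _)
  block-growth k (suc r) h = begin
    (B + suc r) * T k + suc r            ≡⟨ shift B r (T k) ⟩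
    (B + r) * T k + r + suc (T k)        ≤⟨ +-mono-≤ (block-growth k r k+r≤n) (s≤s (T-mono k r k+r≤n)) ⟩
    B * T (k + r) + suc (T (k + r))      ≤⟨ +-monoʳ-≤ _ (heavy k+r<n) ⟩
    B * T (k + r) + B * c (k + r)        ≡⟨ *-distribˡ-+ B _ _ ⟨
    B * (T (k + r) + c (k + r))          ≡⟨ cong (B *_) (step k+r<n) ⟨
    B * T (suc (k + r))                  ≡⟨ cong (λ i → B * T i) (+-suc k r) ⟨
    B * T (k + suc r)                    ∎
    where
    open ≤-Reasoning
    k+r<n : suc (k + r) ≤ n
    k+r<n = subst (_≤ n) (+-suc k r) h
    k+r≤n : k + r ≤ n
    k+r≤n = <⇒≤ k+r<n
    shift : ∀ B r X → (B + suc r) * X + suc r ≡ (B + r) * X + r + suc X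
    shift = solve-∀

  doubling : ∀ k → k + B ≤ n → 2 * suc (T k) ≤ suc (T (k + B))
  doubling k h rewrite *-suc 2 (T k) = s≤s (*-cancelˡ-≤ B (begin
    B * suc (2 * T k)        ≡⟨ double B (T k) ⟨
    (B + B) * T k + B        ≤⟨ block-growth k B h ⟩
    B * T (k + B)            ∎))
    where
    open ≤-Reasoning
    double : ∀ B X → (B + B) * X + B ≡ B * suc (2 * X)
    double = solve-∀

  iterated-doubling : ∀ s → s * B ≤ n → 2 ^ s * suc (T 0) ≤ suc (T (s * B))
  iterated-doubling zero    _ = ≤-reflexive (+-identityʳ _)
  iterated-doubling (suc s) h = begin
    2 * 2 ^ s * suc (T 0)      ≡⟨ *-assoc 2 (2 ^ s) (suc (T 0)) ⟩
    2 * (2 ^ s * suc (T 0))    ≤⟨ *-monoʳ-≤ 2 (iterated-doubling s (≤-trans (m≤n+m _ B) h)) ⟩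
    2 * suc (T (s * B))        ≤⟨ doubling (s * B) (subst (_≤ n) (+-comm B (s * B)) h) ⟩
    suc (T (s * B + B))        ≡⟨ cong (suc ∘ T) (+-comm (s * B) B) ⟩
    suc (T (suc s * B))        ∎
    where open ≤-Reasoning

  run-growth : 2 ^ (n / B) * suc (T 0) ≤ suc (T n)
  run-growth = begin
    2 ^ (n / B) * suc (T 0)                ≤⟨ iterated-doubling (n / B) (m/n*n≤m n B) ⟩
    suc (T (n / B * B))                    ≤⟨ s≤s (T-mono (n / B * B) (n ∸ n / B * B) (≤-reflexive whole)) ⟩
    suc (T (n / B * B + (n ∸ n / B * B)))  ≡⟨ cong (suc ∘ T) whole ⟩
    suc (T n)                              ∎
    where
    open ≤-Reasoning
    whole : n / B * B + (n ∸ n / B * B) ≡ n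
    whole = m+[n∸m]≡n (m/n*n≤m n B)

run-length-bound : ∀ b n s → n < suc s * suc b → (2 + s) * 12 ≤ suc b → ¬ (b * b ≤ 12 * n + 9)
run-length-bound b n s n<[1+s]B [2+s]12≤B b²≤12n+9 = <-irrefl refl (begin-strict
  B * B                          <⟨ m<m+n (B * B) (s≤s z≤n) ⟩
  B * B + suc (10 * b + 13)      ≡⟨ square b ⟨
  b * b + 3 + 12 * B             ≤⟨ +-monoˡ-≤ (12 * B) b²+3≤12[1+n] ⟩
  12 * suc n + 12 * B            ≤⟨ +-monoˡ-≤ (12 * B) (*-monoʳ-≤ 12 n<[1+s]B) ⟩
  12 * (suc s * B) + 12 * B      ≡⟨ regroup s B ⟩
  (2 + s) * 12 * B               ≤⟨ *-monoˡ-≤ B [2+s]12≤B ⟩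
  B * B                          ∎)
  where
  open ≤-Reasoning
  B : ℕ
  B = suc b
  square : ∀ b → b * b + 3 + 12 * suc b ≡ suc b * suc b + suc (10 * b + 13)
  square = solve-∀
  twelve : ∀ n → 12 * n + 9 + 3 ≡ 12 * suc n
  twelve = solve-∀
  b²+3≤12[1+n] : b * b + 3 ≤ 12 * suc n
  b²+3≤12[1+n] = subst (b * b + 3 ≤_) (twelve n) (+-monoˡ-≤ 3 b²≤12n+9)
  regroup : ∀ s B → 12 * (suc s * B) + 12 * B ≡ (2 + s) * 12 * B
  regroup = solve-∀

heavy-run-short : ∀ {b n m} (T c : ℕ → ℕ) →
  (∀ {k} → k < n → T (suc k) ≡ T k + c k) →
  (∀ {k} → k < n → T k < suc b * c k) →
  m ^ 12 ≤ 2 ^ suc b → 7 ≤ T 0 → T n ≤ m → ¬ (b * b ≤ 12 * n + 9)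
heavy-run-short {b} {n} {m} T c step heavy m¹²≤2ᴮ 7≤T₀ Tₙ≤m =
  run-length-bound b n s (m<[1+m/n]*n n B) [2+s]12≤B
  where
  B s : ℕ
  B = suc b
  s = n / B
  open HeavyRun B n T c step heavy
  open ≤-Reasoning
  1≤m : 1 ≤ m
  1≤m = ≤-trans (s≤s z≤n) (≤-trans 7≤T₀ (≤-trans (T-mono 0 n ≤-refl) Tₙ≤m))
  2^[2+s]≤m : 2 ^ (2 + s) ≤ m
  2^[2+s]≤m = *-cancelˡ-≤ 2 (begin
    2 ^ (3 + s)         ≡⟨ ^-distribˡ-+-* 2 3 s ⟩
    8 * 2 ^ s           ≤⟨ *-monoˡ-≤ (2 ^ s) (s≤s 7≤T₀) ⟩
    suc (T 0) * 2 ^ s   ≡⟨ *-comm (suc (T 0)) (2 ^ s) ⟩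
    2 ^ s * suc (T 0)   ≤⟨ run-growth ⟩
    suc (T n)           ≤⟨ s≤s Tₙ≤m ⟩
    1 + m               ≤⟨ +-monoˡ-≤ m 1≤m ⟩
    m + m               ≡⟨ cong (m +_) (+-identityʳ m) ⟨
    2 * m               ∎)
  [2+s]12≤B : (2 + s) * 12 ≤ B
  [2+s]12≤B = ^-cancelˡ-≤ 2 (s≤s (s≤s z≤n)) (begin
    2 ^ ((2 + s) * 12)  ≡⟨ ^-*-assoc 2 (2 + s) 12 ⟨
    (2 ^ (2 + s)) ^ 12  ≤⟨ ^-monoˡ-≤ 12 2^[2+s]≤m ⟩
    m ^ 12              ≤⟨ m¹²≤2ᴮ ⟩
    2 ^ B               ∎)

module NoBalancedIndex
  (m D b : ℕ) (a : ℕ → ℕ)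
  (2≤m : 2 ≤ m)
  (positive : ∀ i → 1 ≤ i → i ≤ D → 0 < a i)
  (logSq : LogSqBound m D)
  (total≤m : sumFrom a 1 D ≤ m)
  (2ᵇ<m¹² : 2 ^ b < m ^ 12)
  (m¹²≤2ᴮ : m ^ 12 ≤ 2 ^ suc b)
  (unbalanced : ∀ j → D ≤ 4 * j → 4 * j ≤ 3 * D → 1 ≤ j → j ≤ D →
    ¬ (LogMulLe (12 * a j) m (sumFrom a 1 (j ∸ 1)) × LogMulLe (12 * a j) m (sumFrom a (suc j) (D ∸ j))))
  where

  open PrefixSuffix a D
  open ≤-Reasoning

  q mid end : ℕ
  q   = D / 4
  mid = q + q
  end = mid + q

  end+q≤D : end + q ≤ D
  end+q≤D = subst (_≤ D) (four q) (m/n*n≤m D 4)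
    where
    four : ∀ q → q * 4 ≡ q + q + q + q
    four = solve-∀

  end≤D : end ≤ D
  end≤D = ≤-trans (m≤m+n end q) end+q≤D

  mid≤D : mid ≤ D
  mid≤D = ≤-trans (m≤m+n mid q) end≤D

  D<4[1+q] : D < 4 * suc q
  D<4[1+q] = subst (D <_) (*-comm (suc q) 4) (m<[1+m/n]*n D 4)

  D≤3+4q : D ≤ 3 + 4 * q
  D≤3+4q = s≤s⁻¹ (subst (D <_) (*-suc 4 q) D<4[1+q])

  -- 6/7 < 1 ≤ log m, so LogSqBound gives 49 * D ≥ 48 * 36 ≥ 49 * 28.
  7≤q : 7 ≤ q
  7≤q = /-monoˡ-≤ 4 (*-cancelʳ-≤ 28 D 49 (≤-trans (m≤m+n 1372 356) (logSq 6 7 (s≤s z≤n) 2⁶<m⁷)))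
    where
    2⁶<m⁷ : 2 ^ 6 < m ^ 7
    2⁶<m⁷ = ≤-trans (m≤m+n 65 63) (^-monoˡ-≤ 7 2≤m)

  b²≤12q+9 : b * b ≤ 12 * q + 9
  b²≤12q+9 = *-cancelˡ-≤ 48 (begin
    48 * (b * b)          ≤⟨ logSq b 12 (s≤s z≤n) 2ᵇ<m¹² ⟩
    D * 144               ≤⟨ *-monoˡ-≤ 144 D≤3+4q ⟩
    (3 + 4 * q) * 144     ≡⟨ scale q ⟩
    48 * (12 * q + 9)     ∎)
    where
    scale : ∀ q → (3 + 4 * q) * 144 ≡ 48 * (12 * q + 9)
    scale = solve-∀

  window-unbalanced : ∀ {j} → q < j → j ≤ end →
    ¬ (LogMulLe (12 * a j) m (prefix (j ∸ 1)) × LogMulLe (12 * a j) m (suffix j))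
  window-unbalanced {j} q<j j≤end = unbalanced j
    (<⇒≤ (<-≤-trans D<4[1+q] (*-monoʳ-≤ 4 q<j)))
    (begin
      4 * j          ≤⟨ *-monoʳ-≤ 4 j≤end ⟩
      4 * end        ≡⟨ three-quarters q ⟩
      3 * (end + q)  ≤⟨ *-monoʳ-≤ 3 end+q≤D ⟩
      3 * D          ∎)
    (≤-trans (s≤s z≤n) q<j)
    (≤-trans j≤end end≤D)
    where
    three-quarters : ∀ q → 4 * (q + q + q) ≡ 3 * (q + q + q + q)
    three-quarters = solve-∀

  prefix-heavy : ∀ {j} → q < j → j ≤ end → prefix (j ∸ 1) ≤ suffix j → prefix (j ∸ 1) < suc b * a j
  prefix-heavy {j} q<j j≤end L≤R = ¬LogMulLe⇒< {suc b} {m} {a j} m¹²≤2ᴮ λ okL →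
    window-unbalanced q<j j≤end (okL , LogMulLe-mono {12 * a j} {m} L≤R okL)

  suffix-heavy : ∀ {j} → q < j → j ≤ end → suffix j ≤ prefix (j ∸ 1) → suffix j < suc b * a j
  suffix-heavy {j} q<j j≤end R≤L = ¬LogMulLe⇒< {suc b} {m} {a j} m¹²≤2ᴮ λ okR →
    window-unbalanced q<j j≤end (LogMulLe-mono {12 * a j} {m} R≤L okR , okR)

  prefix≤suffix⇒⊥ : prefix mid ≤ suffix mid → ⊥
  prefix≤suffix⇒⊥ L≤R = heavy-run-short {b} T c step heavy m¹²≤2ᴮ 7≤T₀ Tq≤m b²≤12q+9
    where
    T c : ℕ → ℕ
    T k = prefix (k + q)
    c k = a (suc (k + q))
    step : ∀ {k} → k < q → T (suc k) ≡ T k + c k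
    step {k} _ = prefix-suc (k + q)
    heavy : ∀ {k} → k < q → T k < suc b * c k
    heavy {k} k<q = prefix-heavy (s≤s (m≤n+m q k)) (≤-trans j≤mid (m≤m+n mid q)) (begin
      prefix (k + q)       ≤⟨ prefix-mono (<⇒≤ j≤mid) ⟩
      prefix mid           ≤⟨ L≤R ⟩
      suffix mid           ≤⟨ suffix-anti j≤mid mid≤D ⟩
      suffix (suc (k + q)) ∎)
      where
      j≤mid : suc (k + q) ≤ mid
      j≤mid = +-monoˡ-< q k<q
    7≤T₀ : 7 ≤ T 0
    7≤T₀ = ≤-trans 7≤q (x≤prefix positive (≤-trans (m≤m+n q q) mid≤D))
    Tq≤m : T q ≤ m
    Tq≤m = ≤-trans (prefix-mono mid≤D) total≤m

  suffix≤prefix⇒⊥ : suffix mid ≤ prefix mid → ⊥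
  suffix≤prefix⇒⊥ R≤L = heavy-run-short {b} T c step heavy m¹²≤2ᴮ 7≤T₀ Tq≤m b²≤12q+9
    where
    T c : ℕ → ℕ
    T k = suffix (end ∸ k)
    c k = a (end ∸ k)
    mid<j : ∀ {k} → k < q → mid < end ∸ k
    mid<j k<q = m+n≤o⇒m≤o∸n (suc mid) (+-monoʳ-< mid k<q)
    j≤D : ∀ k → end ∸ k ≤ D
    j≤D k = ≤-trans (m∸n≤m end k) end≤D
    pred-j : ∀ {k} → k < q → suc (end ∸ suc k) ≡ end ∸ k
    pred-j k<q = sym (+-∸-assoc 1 (≤-trans k<q (m≤n+m q mid)))
    step : ∀ {k} → k < q → T (suc k) ≡ T k + c k
    step {k} k<q = trans (suffix-suc (subst (_≤ D) (sym (pred-j k<q)) (j≤D k)))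
                         (cong (λ j → suffix j + a j) (pred-j k<q))
    heavy : ∀ {k} → k < q → T k < suc b * c k
    heavy {k} k<q = suffix-heavy (≤-trans (s≤s (m≤n+m q q)) (mid<j k<q)) (m∸n≤m end k) (begin
      suffix (end ∸ k)       ≤⟨ suffix-anti (<⇒≤ (mid<j k<q)) (j≤D k) ⟩
      suffix mid             ≤⟨ R≤L ⟩
      prefix mid             ≤⟨ prefix-mono (∸-monoˡ-≤ 1 (mid<j k<q)) ⟩
      prefix (end ∸ k ∸ 1)   ∎)
    7≤T₀ : 7 ≤ T 0
    7≤T₀ = ≤-trans 7≤q (≤-trans (m+n≤o⇒m≤o∸n q (subst (_≤ D) (+-comm end q) end+q≤D))
                                (D∸j≤suffix positive end≤D))
    Tq≤m : T q ≤ m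
    Tq≤m = ≤-trans (suffix≤prefix (j≤D q)) total≤m

  absurd : ⊥
  absurd with ≤-total (prefix mid) (suffix mid)
  ... | inj₁ L≤R = prefix≤suffix⇒⊥ L≤R
  ... | inj₂ R≤L = suffix≤prefix⇒⊥ R≤L

lemma3 : (m D : ℕ) (a : ℕ → ℕ) →
    2 ≤ m →
    (∀ i → 1 ≤ i → i ≤ D → 0 < a i) →
    LogSqBound m D →
    sumFrom a 1 D ≤ m →
    Σ ℕ (λ j → (D ≤ 4 * j) × (4 * j ≤ 3 * D) × (1 ≤ j) × (j ≤ D) ×
      LogMulLe (12 * a j) m (sumFrom a 1 (j ∸ 1)) ×
      LogMulLe (12 * a j) m (sumFrom a (suc j) (D ∸ j)))
lemma3 m D a 2≤m positive logSq total≤m =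
  let (b , 2ᵇ<m¹² , m¹²≤2ᴮ) = between-powers-of-2 (≤-trans (s≤s (s≤s z≤n)) (^-monoˡ-≤ 12 2≤m))
      (j , _ , balanced) = decidable-stable (anyUpTo? balanced? (suc D)) λ none →
        NoBalancedIndex.absurd m D b a 2≤m positive logSq total≤m 2ᵇ<m¹² m¹²≤2ᴮ
          λ j D≤4j 4j≤3D 1≤j j≤D ok → none (j , s≤s j≤D , D≤4j , 4j≤3D , 1≤j , j≤D , ok)
  in j , balanced
  where
  balanced? : ∀ j → Dec ((D ≤ 4 * j) × (4 * j ≤ 3 * D) × (1 ≤ j) × (j ≤ D) ×
    LogMulLe (12 * a j) m (sumFrom a 1 (j ∸ 1)) × LogMulLe (12 * a j) m (sumFrom a (suc j) (D ∸ j)))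
  balanced? j = D ≤? 4 * j ×-dec 4 * j ≤? 3 * D ×-dec 1 ≤? j ×-dec j ≤? D ×-dec
    m ^ (12 * a j) ≤? 2 ^ sumFrom a 1 (j ∸ 1) ×-dec m ^ (12 * a j) ≤? 2 ^ sumFrom a (suc j) (D ∸ j)
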